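{- Let $\Gamma$ be an Abelian group of order $n^2$ where $n\geq 3$ is odd. Then there exists a $\Gamma$-magic square $\mathrm{MS}_{\Gamma}(n)$ of side $n$.
   Context: For an Abelian group $(\Gamma,+)$ of order $n^2$, a $\Gamma$-magic square $\mathrm{MS}_{\Gamma}(n)$ (of side $n$) is an $n\times n$ array whose entries are all the elements of $\Gamma$ (each element appearing exactly once) such that all row sums, all column sums, the sum along the main diagonal and the sum along the backward main diagonal are equal to the same element $\mu\in\Gamma$. -}

module Defs where

open import Level using (Level)
open import Algebra.Bundles using (AbelianGroup)
open import Data.Nat using (ℕ; zero; suc; _*_)
open import Data.Fin using (Fin; zero; suc; opposite)
open import Data.Product using (_×_; _,_; uncurry)
open import Function.Definitions using (Bijective)
open import Relation.Binary.PropositionalEquality using (_≡_)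

module _ {c ℓ : Level} (G : AbelianGroup c ℓ) where
  open AbelianGroup G

  ∑ : (n : ℕ) → (Fin n → Carrier) → Carrier
  ∑ zero    f = ε
  ∑ (suc n) f = f zero ∙ ∑ n (λ i → f (suc i))

  HasOrder : ℕ → Set (c Level.⊔ ℓ)
  HasOrder m = Σ' (Fin m → Carrier) (λ g → Bijective _≡_ _≈_ g)
    where
      open import Data.Product using () renaming (Σ to Σ')

  record MagicSquare (n : ℕ) : Set (c Level.⊔ ℓ) where
    field
      entry       : Fin n → Fin n → Carrier
      allOnce     : Bijective _≡_ _≈_ (uncurry entry)
      μ           : Carrier
      rowSum      : ∀ i → ∑ n (λ j → entry i j) ≈ μ
      colSum      : ∀ j → ∑ n (λ i → entry i j) ≈ μ
      diagSum     : ∑ n (λ i → entry i i) ≈ μ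
      antiDiagSum : ∑ n (λ i → entry i (opposite i)) ≈ μ

-- Call α : Fin n → Γ balanced if Σ α = n·α(c) for some centre c. It suffices to find balanced
-- α, β : Fin n → Γ such that (u, v) ↦ α u + β v is a bijection onto Γ: the square with entries
-- α(i + j + a′) + β(i − j + b′) (indices mod n) then has every row and column running through all
-- values of α and of β, while on each diagonal one index is 2i + const, again a permutation as n is
-- odd, and the other is constant and can be made the centre.
-- Such α, β are grown by adjoining one element x at a time while H = α + β is a subgroup with
-- |α|, |β| dividing n. If x has order q modulo H, Lagrange's theorem for H + ⟨x⟩ gives
-- |α|·|β|·q ∣ n², so q = q′·g with |α|·g ∣ n and |β|·q′ ∣ n. Replacing α by the progressions
-- α u + w·x (w < g) and β by β v + w′·g·x (w′ < q′) enumerates H + ⟨x⟩, and keeps both balanced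
-- because g and q′ divide n and are therefore odd.

module Submission where

open import Defs
open import Level using (Level; _⊔_)
open import Algebra.Bundles using (AbelianGroup; Group)
open import Data.Nat using (ℕ; zero; suc; _+_; _*_; _∸_; _≤_; _<_; _%_; _/_; s≤s; z<s;
  NonZero; ≢-nonZero; ≢-nonZero⁻¹; s≤s⁻¹)
open import Data.Nat.Properties
open import Data.Nat.DivMod
  using (m≡m%n+[m/n]*n; m%n<n; m/n*n≡m; [m+n]%n≡m%n; m<n⇒m%n≡m; %-distribˡ-+; _mod_)
open import Data.Nat.Divisibility
open import Data.Nat.GCD using (gcd; gcd[m,n]∣m; gcd[m,n]∣n; gcd[m,n]≢0)
open import Data.Nat.Coprimality using (Coprime; coprime-divisor; coprime-/gcd; 1-coprimeTo)
  renaming (sym to coprime-sym)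
open import Data.Nat.Tactic.RingSolver using (solve-∀)
open import Data.Fin
  using (Fin; zero; suc; toℕ; fromℕ; fromℕ<; inject₁; _↑ˡ_; _↑ʳ_; combine; remQuot; opposite; punchOut)
import Data.Fin.Properties as Fin
open import Data.Product using (Σ; ∃; ∃-syntax; ∃₂; _×_; _,_; proj₁; proj₂; uncurry)
open import Data.Product.Function.NonDependent.Propositional using (_×-↔_)
open import Data.Sum using (_⊎_; inj₁; inj₂; [_,_]′)
open import Function using (_∘_; _↔_; Inverse; mk↔ₛ′)
open import Function.Construct.Composition using (_↔-∘_)
open import Function.Construct.Identity using (↔-id)
open import Function.Construct.Symmetry using (↔-sym)
open import Function.Definitions using (Bijective)
open import Relation.Binary.PropositionalEquality
  using (_≡_; _≢_; refl; sym; trans; cong; cong₂; subst; subst₂; module ≡-Reasoning)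
open import Relation.Nullary using (¬_; Dec; yes; no)
open import Relation.Nullary.Negation using (contradiction)
open import Relation.Unary using (Pred; Decidable)

n+n≡n*2 : ∀ n → n + n ≡ n * 2
n+n≡n*2 n = trans (cong (n +_) (sym (+-identityʳ n))) (*-comm 2 n)

odd-divisor : ∀ {d n} → d ∣ n → n % 2 ≡ 1 → ∃[ t ] d ≡ suc (t + t)
odd-divisor {d} {n} d∣n n%2≡1 with d % 2 in d%2 | m%n<n d 2
... | 0 | _ = contradiction (trans (sym (n∣m⇒m%n≡0 n 2 2∣n)) n%2≡1) λ ()
  where 2∣n : 2 ∣ n
        2∣n = ∣-trans (m%n≡0⇒n∣m d 2 d%2) d∣n
... | 1 | _ = d / 2 , (begin
  d                  ≡⟨ m≡m%n+[m/n]*n d 2 ⟩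
  d % 2 + d / 2 * 2  ≡⟨ cong (_+ d / 2 * 2) d%2 ⟩
  suc (d / 2 * 2)    ≡⟨ cong suc (n+n≡n*2 (d / 2)) ⟨
  suc (d / 2 + d / 2) ∎)
  where open ≡-Reasoning
... | suc (suc _) | s≤s (s≤s ())

odd-coprime-2 : ∀ t → Coprime (suc (t + t)) 2
odd-coprime-2 t {d} (d∣odd , d∣2) = ∣1⇒≡1 (∣m+n∣m⇒∣n (subst (d ∣_) (+-comm 1 (t + t)) d∣odd) d∣t+t)
  where d∣t+t : d ∣ t + t
        d∣t+t = ∣-trans d∣2 (divides t (n+n≡n*2 t))

%2≡1⇒coprime-2 : ∀ {n} → n % 2 ≡ 1 → Coprime n 2
%2≡1⇒coprime-2 {n} n%2≡1 with t , refl ← odd-divisor {n} ∣-refl n%2≡1 = odd-coprime-2 t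

≤⇒∃+ : ∀ {m n} → m ≤ n → ∃[ e ] n ≡ e + m
≤⇒∃+ {m} {n} m≤n = n ∸ m , sym (m∸n+n≡m m≤n)

∣-<⇒≡0 : ∀ {n d} → n ∣ d → d < n → d ≡ 0
∣-<⇒≡0 {d = zero}  _   _   = refl
∣-<⇒≡0 {d = suc _} n∣d d<n = contradiction n∣d (>⇒∤ d<n)

module _ (n : ℕ) .{{_ : NonZero n}} where

  %-≡⇒∣ : ∀ x d → x % n ≡ (x + d) % n → n ∣ d
  %-≡⇒∣ x d eq = ∣m+n∣m⇒∣n (subst (n ∣_) quotients (n∣m*n ((x + d) / n))) (n∣m*n (x / n))
    where
    open ≡-Reasoning
    quotients : (x + d) / n * n ≡ x / n * n + d
    quotients = +-cancelˡ-≡ (x % n) _ _ (begin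
      x % n + (x + d) / n * n        ≡⟨ cong (_+ (x + d) / n * n) eq ⟩
      (x + d) % n + (x + d) / n * n  ≡⟨ m≡m%n+[m/n]*n (x + d) n ⟨
      x + d                          ≡⟨ cong (_+ d) (m≡m%n+[m/n]*n x n) ⟩
      x % n + x / n * n + d          ≡⟨ +-assoc (x % n) _ d ⟩
      x % n + (x / n * n + d)        ∎)

  affine-%-injective-≤ : ∀ {c} → Coprime n c → ∀ k {x y} → x ≤ y → y < n →
                         (c * x + k) % n ≡ (c * y + k) % n → x ≡ y
  affine-%-injective-≤ {c} n⊥c k {x} {y} x≤y y<n eq = begin
    x                ≡⟨ +-identityʳ x ⟨
    x + 0            ≡⟨ cong (x +_) e≡0 ⟨
    x + (y ∸ x)      ≡⟨ m+[n∸m]≡n x≤y ⟩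
    y                ∎
    where
    open ≡-Reasoning
    e : ℕ
    e = y ∸ x
    shift : c * y + k ≡ (c * x + k) + c * e
    shift = trans (cong (λ z → c * z + k) (sym (m+[n∸m]≡n x≤y))) (lemma c x e k)
      where
      lemma : ∀ c x e k → c * (x + e) + k ≡ (c * x + k) + c * e
      lemma = solve-∀
    e≡0 : e ≡ 0
    e≡0 = ∣-<⇒≡0 (coprime-divisor n⊥c (%-≡⇒∣ (c * x + k) (c * e) (trans eq (cong (_% n) shift))))
                 (≤-<-trans (m∸n≤m y x) y<n)

  affine-%-injective : ∀ {c} → Coprime n c → ∀ k {x y} → x < n → y < n →
                       (c * x + k) % n ≡ (c * y + k) % n → x ≡ y
  affine-%-injective n⊥c k {x} {y} x<n y<n eq with ≤-total x y
  ... | inj₁ x≤y = affine-%-injective-≤ n⊥c k x≤y y<n eq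
  ... | inj₂ y≤x = sym (affine-%-injective-≤ n⊥c k y≤x x<n (sym eq))

∣-*-split : ∀ {q A B} .{{_ : NonZero A}} → q ∣ A * B → ∃₂ λ g q′ → q ≡ q′ * g × g ∣ A × q′ ∣ B
∣-*-split {q} {A} {B} q∣AB = g , q / g , sym (m/n*n≡m g∣q) , g∣A , q′∣B
  where
  g : ℕ
  g = gcd q A
  g∣q : g ∣ q
  g∣q = gcd[m,n]∣m q A
  g∣A : g ∣ A
  g∣A = gcd[m,n]∣n q A
  instance
    g≢0 : NonZero g
    g≢0 = ≢-nonZero (gcd[m,n]≢0 q A (inj₂ (≢-nonZero⁻¹ A)))
  rearrange : ∀ A′ g B → A′ * g * B ≡ A′ * B * g
  rearrange = solve-∀
  q′∣B : q / g ∣ B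
  q′∣B = coprime-divisor (coprime-/gcd q A) (*-cancelʳ-∣ g
           (subst₂ _∣_ (sym (m/n*n≡m g∣q)) (trans (cong (_* B) (sym (m/n*n≡m g∣A))) (rearrange (A / g) g B)) q∣AB))

divisor-nonZero : ∀ {a n} .{{_ : NonZero n}} → a ∣ n → NonZero a
divisor-nonZero {zero}  {n} 0∣n = contradiction (0∣⇒≡0 0∣n) (≢-nonZero⁻¹ n)
divisor-nonZero {suc _}     _   = _

index-split : ∀ {a b q n} .{{_ : NonZero n}} → a ∣ n → b ∣ n → a * b * q ∣ n * n →
              ∃₂ λ g q′ → q ≡ q′ * g × a * g ∣ n × b * q′ ∣ n
index-split {a} {b} {q} {n} a∣n b∣n abq∣nn = finish (∣-*-split q∣AB)
  where
  A B : ℕ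
  A = quotient a∣n
  B = quotient b∣n
  instance
    A≢0 : NonZero A
    A≢0 = quotient≢0 a∣n
    ab≢0 : NonZero (a * b)
    ab≢0 = m*n≢0 a b {{divisor-nonZero a∣n}} {{divisor-nonZero b∣n}}
  rearrange : ∀ a A b B → a * A * (b * B) ≡ a * b * (A * B)
  rearrange = solve-∀
  q∣AB : q ∣ A * B
  q∣AB = *-cancelˡ-∣ (a * b) (subst (a * b * q ∣_)
           (trans (cong₂ _*_ (m∣n⇒n≡m*quotient a∣n) (m∣n⇒n≡m*quotient b∣n)) (rearrange a A b B)) abq∣nn)
  finish : (∃₂ λ g q′ → q ≡ q′ * g × g ∣ A × q′ ∣ B) →
           ∃₂ λ g q′ → q ≡ q′ * g × a * g ∣ n × b * q′ ∣ n
  finish (g , q′ , q≡q′g , g∣A , q′∣B) =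
    g , q′ , q≡q′g , subst (a * g ∣_) (sym (m∣n⇒n≡m*quotient a∣n)) (*-monoʳ-∣ a g∣A)
                   , subst (b * q′ ∣_) (sym (m∣n⇒n≡m*quotient b∣n)) (*-monoʳ-∣ b q′∣B)

divisors-product-square : ∀ {a b n} .{{_ : NonZero n}} → a ∣ n → b ∣ n → a * b ≡ n * n → a ≡ n × b ≡ n
divisors-product-square {a} {b} {n} a∣n b∣n ab≡nn = a≡n , *-cancelˡ-≡ b n n (trans (cong (_* b) (sym a≡n)) ab≡nn)
  where
  a≡n : a ≡ n
  a≡n with m≤n⇒m<n∨m≡n (∣⇒≤ a∣n)
  ... | inj₂ a≡n = a≡n
  ... | inj₁ a<n = contradiction ab≡nn (<⇒≢ (≤-<-trans (*-monoʳ-≤ a (∣⇒≤ b∣n)) (*-monoˡ-< n a<n)))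

triangle : ℕ → ℕ
triangle zero    = 0
triangle (suc n) = triangle n + n

triangle-double : ∀ n → triangle n + triangle n + n ≡ n * n
triangle-double zero    = refl
triangle-double (suc n) = trans (split (triangle n) n) (trans (cong (_+ suc (n + n)) (triangle-double n)) (square n))
  where
  split : ∀ T n → (T + n) + (T + n) + suc n ≡ (T + T + n) + suc (n + n)
  split = solve-∀
  square : ∀ n → n * n + suc (n + n) ≡ suc n * suc n
  square = solve-∀

triangle-odd : ∀ t → triangle (suc (t + t)) ≡ t * suc (t + t)
triangle-odd t = *-cancelʳ-≡ _ _ 2 (trans (sym (n+n≡n*2 (triangle h))) (trans doubled (n+n≡n*2 (t * h))))
  where
  h : ℕ
  h = suc (t + t)
  square : ∀ t → suc (t + t) * suc (t + t) ≡ (t * suc (t + t) + t * suc (t + t)) + suc (t + t)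
  square = solve-∀
  doubled : triangle h + triangle h ≡ t * h + t * h
  doubled = +-cancelʳ-≡ h _ _ (trans (triangle-double h) (square t))

least : ∀ {p} {P : Pred ℕ p} → Decidable P → ∀ {m} → P m → ∃[ k ] P k × (∀ {j} → j < k → ¬ P j)
least {P = P} P? {m} pm with search (suc m)
  where
  search : ∀ m → (∃[ k ] P k × (∀ {j} → j < k → ¬ P j)) ⊎ (∀ {j} → j < m → ¬ P j)
  search zero = inj₂ λ ()
  search (suc m) with search m
  ... | inj₁ found = inj₁ found
  ... | inj₂ none with P? m
  ...   | yes pm = inj₁ (m , pm , none)
  ...   | no ¬pm = inj₂ λ j<1+m → [ none , (λ { refl → ¬pm }) ]′ (m≤n⇒m<n∨m≡n (s≤s⁻¹ j<1+m))
... | inj₁ found = found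
... | inj₂ none  = contradiction pm (none (n<1+n m))

bounded-ascent : ∀ {a p} {A : Set a} {P : Pred A p} (size : A → ℕ) (N : ℕ) →
                 (∀ x → size x ≤ N) → (∀ x → P x ⊎ ∃[ y ] size x < size y) → A → ∃ P
bounded-ascent {P = P} size N bounded step x₀ = climb (suc N) x₀ (≤-trans (n<1+n N) (m≤n+m (suc N) (size x₀)))
  where
  climb : ∀ fuel x → N < size x + fuel → ∃ P
  climb zero       x N<x = contradiction (bounded x) (<⇒≱ (subst (N <_) (+-identityʳ (size x)) N<x))
  climb (suc fuel) x N<x with step x
  ... | inj₁ px       = x , px
  ... | inj₂ (y , x<y) = climb fuel y (<-≤-trans N<x (≤-trans (≤-reflexive (+-suc (size x) fuel)) (+-monoˡ-≤ fuel x<y)))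

remQuot-injective : ∀ {m} n {i j : Fin (m * n)} → remQuot {m} n i ≡ remQuot n j → i ≡ j
remQuot-injective {m} n {i} {j} eq =
  trans (sym (Fin.combine-remQuot {m} n i)) (trans (cong (uncurry combine) eq) (Fin.combine-remQuot {m} n j))

opposite-injective : ∀ {n} {i j : Fin n} → opposite i ≡ opposite j → i ≡ j
opposite-injective {i = i} {j} eq =
  trans (sym (Fin.opposite-involutive i)) (trans (cong opposite eq) (Fin.opposite-involutive j))

Fin-injective⇒surjective : ∀ {m} (f : Fin m → Fin m) → (∀ {x y} → f x ≡ f y → x ≡ y) → ∀ y → ∃ λ x → f x ≡ y
Fin-injective⇒surjective {suc m} f f-injective y with Fin.any? (λ x → f x Fin.≟ y)
... | yes hit = hit
... | no miss = contradiction (Fin.injective⇒≤ punched-injective) 1+n≰n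
  where
  avoids : ∀ x → y ≢ f x
  avoids x y≡fx = miss (x , sym y≡fx)
  punched-injective : ∀ {x x′} → punchOut (avoids x) ≡ punchOut (avoids x′) → x ≡ x′
  punched-injective {x} {x′} eq = f-injective (Fin.punchOut-injective (avoids x) (avoids x′) eq)

-- combine (combine u w) (combine v w′) ↦ combine (combine u v) (combine w′ w)
regroup : ∀ {a g b h} → Fin ((a * g) * (b * h)) ↔ Fin ((a * b) * (h * g))
regroup {a} {g} {b} {h} =
  ↔-sym (Fin.*↔× {a * b} {h * g}) ↔-∘ ((↔-sym (Fin.*↔× {a} {b}) ×-↔ ↔-sym (Fin.*↔× {h} {g})) ↔-∘
    (shuffle ↔-∘ ((Fin.*↔× {a} {g} ×-↔ Fin.*↔× {b} {h}) ↔-∘ Fin.*↔× {a * g} {b * h})))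
  where
  shuffle : ∀ {A B C D : Set} → ((A × B) × (C × D)) ↔ ((A × C) × (D × B))
  shuffle = mk↔ₛ′ (λ ((a , b) , (c , d)) → (a , c) , (d , b)) (λ ((a , c) , (d , b)) → (a , b) , (c , d))
                  (λ _ → refl) (λ _ → refl)

module Latin (m : ℕ) where

  n : ℕ
  n = suc m

  latin : ℕ → Fin n → Fin n → Fin n
  latin k i j = (toℕ i + toℕ j + k) mod n

  toℕ-latin : ∀ k i j → toℕ (latin k i j) ≡ (toℕ i + toℕ j + k) % n
  toℕ-latin k i j = Fin.toℕ-fromℕ< (m%n<n (toℕ i + toℕ j + k) n)

  affine-injective : ∀ {c} k → Coprime n c → (f : Fin n → Fin n) →
                     (∀ i → toℕ (f i) ≡ (c * toℕ i + k) % n) → ∀ {i j} → f i ≡ f j → i ≡ j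
  affine-injective k n⊥c f f≡ {i} {j} eq = Fin.toℕ-injective
    (affine-%-injective n n⊥c k (Fin.toℕ<n i) (Fin.toℕ<n j) (trans (sym (f≡ i)) (trans (cong toℕ eq) (f≡ j))))

  n⊥1 : Coprime n 1
  n⊥1 = coprime-sym (1-coprimeTo n)

  latin-injectiveʳ : ∀ k i {j j′} → latin k i j ≡ latin k i j′ → j ≡ j′
  latin-injectiveʳ k i = affine-injective (toℕ i + k) n⊥1 (latin k i)
    (λ j → trans (toℕ-latin k i j) (cong (_% n) (shape (toℕ i) (toℕ j) k)))
    where
    shape : ∀ i j k → i + j + k ≡ 1 * j + (i + k)
    shape = solve-∀

  latin-injectiveˡ : ∀ k j {i i′} → latin k i j ≡ latin k i′ j → i ≡ i′
  latin-injectiveˡ k j = affine-injective (toℕ j + k) n⊥1 (λ i → latin k i j)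
    (λ i → trans (toℕ-latin k i j) (cong (_% n) (shape (toℕ i) (toℕ j) k)))
    where
    shape : ∀ i j k → i + j + k ≡ 1 * i + (j + k)
    shape = solve-∀

  latin-diagonal-injective : Coprime n 2 → ∀ k {i i′} → latin k i i ≡ latin k i′ i′ → i ≡ i′
  latin-diagonal-injective n⊥2 k = affine-injective k n⊥2 (λ i → latin k i i)
    (λ i → trans (toℕ-latin k i i) (cong (_% n) (shape (toℕ i) k)))
    where
    shape : ∀ i k → i + i + k ≡ 2 * i + k
    shape = solve-∀

  toℕ+opposite : ∀ (i : Fin n) → toℕ i + toℕ (opposite i) ≡ m
  toℕ+opposite i = trans (cong (toℕ i +_) (Fin.opposite-prop i)) (m+[n∸m]≡n (s≤s⁻¹ (Fin.toℕ<n i)))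

  -- The shift by 1 + c makes the anti-diagonal i + (m − i) = m land on c.
  latin-antidiagonal : ∀ c i → latin (suc (toℕ c)) i (opposite i) ≡ c
  latin-antidiagonal c i = Fin.toℕ-injective (begin
    toℕ (latin (suc (toℕ c)) i (opposite i))  ≡⟨ toℕ-latin _ i (opposite i) ⟩
    (toℕ i + toℕ (opposite i) + suc (toℕ c)) % n  ≡⟨ cong (λ s → (s + suc (toℕ c)) % n) (toℕ+opposite i) ⟩
    (m + suc (toℕ c)) % n                      ≡⟨ cong (_% n) (trans (+-suc m (toℕ c)) (+-comm n (toℕ c))) ⟩
    (toℕ c + n) % n                            ≡⟨ [m+n]%n≡m%n (toℕ c) n ⟩
    toℕ c % n                                  ≡⟨ m<n⇒m%n≡m (Fin.toℕ<n c) ⟩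
    toℕ c                                      ∎)
    where open ≡-Reasoning

  -- The sum of the two entries is 2i + const (mod n), which determines i since n is odd.
  latin-orthogonal : Coprime n 2 → ∀ k k′ {i j i′ j′} → latin k i j ≡ latin k i′ j′ →
                     latin k′ i (opposite j) ≡ latin k′ i′ (opposite j′) → i ≡ i′ × j ≡ j′
  latin-orthogonal n⊥2 k k′ {i} {j} {i′} {j′} eq eq′ = i≡i′ , j≡j′
    where
    open ≡-Reasoning
    shape : ∀ i j o k k′ → (i + j + k) + (i + o + k′) ≡ 2 * i + (j + o + k + k′)
    shape = solve-∀
    residue : ∀ i j → (toℕ (latin k i j) + toℕ (latin k′ i (opposite j))) % n ≡ (2 * toℕ i + (m + k + k′)) % n
    residue i j = begin
      (toℕ (latin k i j) + toℕ (latin k′ i (opposite j))) % n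
        ≡⟨ cong₂ (λ a b → (a + b) % n) (toℕ-latin k i j) (toℕ-latin k′ i (opposite j)) ⟩
      ((toℕ i + toℕ j + k) % n + (toℕ i + toℕ (opposite j) + k′) % n) % n
        ≡⟨ %-distribˡ-+ (toℕ i + toℕ j + k) _ n ⟨
      ((toℕ i + toℕ j + k) + (toℕ i + toℕ (opposite j) + k′)) % n
        ≡⟨ cong (_% n) (shape (toℕ i) (toℕ j) (toℕ (opposite j)) k k′) ⟩
      (2 * toℕ i + (toℕ j + toℕ (opposite j) + k + k′)) % n
        ≡⟨ cong (λ s → (2 * toℕ i + (s + k + k′)) % n) (toℕ+opposite j) ⟩
      (2 * toℕ i + (m + k + k′)) % n ∎
    i≡i′ : i ≡ i′
    i≡i′ = Fin.toℕ-injective (affine-%-injective n n⊥2 (m + k + k′) (Fin.toℕ<n i) (Fin.toℕ<n i′)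
      (trans (sym (residue i j)) (trans (cong₂ (λ a b → (toℕ a + toℕ b) % n) eq eq′) (residue i′ j′))))
    j≡j′ : j ≡ j′
    j≡j′ = latin-injectiveʳ k i (trans eq (cong (λ i → latin k i j′) (sym i≡i′)))

module _ {c ℓ} (G : AbelianGroup c ℓ) where
  open AbelianGroup G renaming (refl to ≈-refl; sym to ≈-sym; trans to ≈-trans)
  open Group group using (_//_)
  open import Algebra.Properties.AbelianGroup G
    using (⁻¹-anti-homo-//; ⁻¹-involutive; ⁻¹-∙-comm; //-rightDividesʳ; //-rightDividesˡ; //-cong₂)
  open import Algebra.Properties.CommutativeMonoid.Mult commutativeMonoid
    using (×-homo-+; ×-congˡ; ×-congʳ; ×-assocˡ; ×-distrib-+) renaming (_×_ to _·_)
  open import Algebra.Properties.CommutativeMonoid.Sum commutativeMonoid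
    using (sum; sum-cong-≋; sum-replicate; sum-replicate-zero; sum-init-last; ∑-distrib-+; ∑-permute)
  open import Algebra.Solver.CommutativeMonoid commutativeMonoid using (solve; _⊕_; _⊜_)
  open import Relation.Binary.Reasoning.Setoid setoid

  //-interchange : ∀ a b c d → (a // b) // (c // d) ≈ (a // c) // (b // d)
  //-interchange a b c d = begin
    (a // b) // (c // d)  ≈⟨ ∙-congˡ (⁻¹-anti-homo-// c d) ⟩
    (a // b) ∙ (d // c)
      ≈⟨ solve 4 (λ a b′ c′ d → (a ⊕ b′) ⊕ (d ⊕ c′) ⊜ (a ⊕ c′) ⊕ (d ⊕ b′)) ≈-refl a (b ⁻¹) (c ⁻¹) d ⟩
    (a // c) ∙ (d // b)   ≈⟨ ∙-congˡ (⁻¹-anti-homo-// b d) ⟨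
    (a // c) // (b // d)  ∎

  //-∙-cancel : ∀ a b → a // (b ∙ a) ≈ b ⁻¹
  //-∙-cancel a b = begin
    a // (b ∙ a)              ≈⟨ ⁻¹-involutive _ ⟨
    (a // (b ∙ a)) ⁻¹ ⁻¹      ≈⟨ ⁻¹-cong (⁻¹-anti-homo-// a (b ∙ a)) ⟩
    ((b ∙ a) // a) ⁻¹         ≈⟨ ⁻¹-cong (//-rightDividesʳ a b) ⟩
    b ⁻¹                      ∎

  //-//-∙-cancel : ∀ y a b → (y // a) // (y // (b ∙ a)) ≈ b
  //-//-∙-cancel y a b = begin
    (y // a) // (y // (b ∙ a))  ≈⟨ //-interchange y a y (b ∙ a) ⟩
    (y // y) // (a // (b ∙ a))  ≈⟨ //-cong₂ (inverseʳ y) (//-∙-cancel a b) ⟩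
    ε // b ⁻¹                   ≈⟨ identityˡ _ ⟩
    b ⁻¹ ⁻¹                     ≈⟨ ⁻¹-involutive b ⟩
    b                           ∎

  //-∙-//-cancel : ∀ y z a b → (y // (b ∙ a)) // (z // a) ≈ (y // z) // b
  //-∙-//-cancel y z a b = ≈-trans (//-interchange y (b ∙ a) z a) (//-cong₂ ≈-refl (//-rightDividesʳ a b))

  //-//-∙-//-∙-cancel : ∀ y z a b c → ((y // a) // (z // (b ∙ a))) // (c ∙ b) ≈ (y // z) // c
  //-//-∙-//-∙-cancel y z a b c = begin
    ((y // a) // (z // (b ∙ a))) // (c ∙ b)  ≈⟨ //-cong₂ (//-interchange y a z (b ∙ a)) ≈-refl ⟩
    ((y // z) // (a // (b ∙ a))) // (c ∙ b)  ≈⟨ //-cong₂ (//-cong₂ ≈-refl (//-∙-cancel a b)) ≈-refl ⟩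
    ((y // z) // b ⁻¹) // (c ∙ b)           ≈⟨ ∙-cong (∙-congˡ (⁻¹-involutive b)) (≈-sym (⁻¹-∙-comm c b)) ⟩
    ((y // z) ∙ b) ∙ (c ⁻¹ ∙ b ⁻¹)
      ≈⟨ solve 4 (λ u b c′ b′ → (u ⊕ b) ⊕ (c′ ⊕ b′) ⊜ (u ⊕ c′) ⊕ (b ⊕ b′)) ≈-refl (y // z) b (c ⁻¹) (b ⁻¹) ⟩
    ((y // z) // c) ∙ (b // b)               ≈⟨ ∙-congˡ (inverseʳ b) ⟩
    ((y // z) // c) ∙ ε                      ≈⟨ identityʳ _ ⟩
    (y // z) // c                            ∎

  record IsSubgroup {p} (P : Pred Carrier p) : Set (c ⊔ ℓ ⊔ p) where
    field
      ≈-closed  : ∀ {x y} → x ≈ y → P x → P y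
      ε-closed  : P ε
      //-closed : ∀ {x y} → P x → P y → P (x // y)

  IsSubgroup-⇔ : ∀ {p r} {P : Pred Carrier p} {Q : Pred Carrier r} →
                 IsSubgroup P → (∀ {y} → P y → Q y) → (∀ {y} → Q y → P y) → IsSubgroup Q
  IsSubgroup-⇔ H P⇒Q Q⇒P = record
    { ≈-closed  = λ x≈y qx → P⇒Q (≈-closed x≈y (Q⇒P qx))
    ; ε-closed  = P⇒Q ε-closed
    ; //-closed = λ qx qy → P⇒Q (//-closed (Q⇒P qx) (Q⇒P qy))
    }
    where open IsSubgroup H

  Image : ∀ {s} → (Fin s → Carrier) → Pred Carrier ℓ
  Image σ y = ∃ λ u → σ u ≈ y

  record SubgroupEnumeration {s} (σ : Fin s → Carrier) : Set (c ⊔ ℓ) where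
    field
      injective : ∀ {u v} → σ u ≈ σ v → u ≡ v
      subgroup  : IsSubgroup (Image σ)

  trivial-enumeration : SubgroupEnumeration {1} (λ _ → ε)
  trivial-enumeration = record
    { injective = λ { {zero} {zero} _ → refl }
    ; subgroup  = record
      { ≈-closed  = λ { x≈y (u , ε≈x) → u , ≈-trans ε≈x x≈y }
      ; ε-closed  = zero , ≈-refl
      ; //-closed = λ { (_ , ε≈x) (_ , ε≈y) → zero , ≈-trans (≈-sym (inverseʳ ε)) (//-cong₂ ε≈x ε≈y) }
      }
    }

  enumeration-reindex : ∀ {m s} {σ : Fin s → Carrier} {τ : Fin m → Carrier} → SubgroupEnumeration σ →
                        (π : Fin m ↔ Fin s) → (∀ k → τ k ≈ σ (Inverse.to π k)) → SubgroupEnumeration τ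
  enumeration-reindex {σ = σ} {τ} E π τ≈σπ = record
    { injective = λ τk≈τk′ → π-injective (injective (≈-trans (≈-sym (τ≈σπ _)) (≈-trans τk≈τk′ (τ≈σπ _))))
    ; subgroup  = IsSubgroup-⇔ subgroup
        (λ (u , σu≈y) → from u , ≈-trans (τ≈σπ (from u)) (≈-trans (reflexive (cong σ (strictlyInverseˡ u))) σu≈y))
        (λ (k , τk≈y) → to k , ≈-trans (≈-sym (τ≈σπ k)) τk≈y)
    }
    where
    open SubgroupEnumeration E
    open Inverse π
    π-injective : ∀ {k k′} → to k ≡ to k′ → k ≡ k′
    π-injective {k} {k′} eq = trans (sym (strictlyInverseʳ k)) (trans (cong from eq) (strictlyInverseʳ k′))

  extend : ∀ {s} → (Fin s → Carrier) → Carrier → (h : ℕ) → Fin (s * h) → Carrier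
  extend {s} σ x h k = σ (proj₁ (remQuot {s} h k)) ∙ toℕ (proj₂ (remQuot {s} h k)) · x

  extend-combine : ∀ {s} (σ : Fin s → Carrier) x h u w → extend σ x h (combine u w) ≈ σ u ∙ toℕ w · x
  extend-combine {s} σ x h u w = reflexive (cong (λ (u , w) → σ u ∙ toℕ w · x) (Fin.remQuot-combine {s} {h} u w))

  pair : ∀ {a b} → (Fin a → Carrier) → (Fin b → Carrier) → Fin (a * b) → Carrier
  pair {a} {b} α β k = α (proj₁ (remQuot {a} b k)) ∙ β (proj₂ (remQuot {a} b k))

  pair-combine : ∀ {a b} (α : Fin a → Carrier) (β : Fin b → Carrier) u v → pair α β (combine u v) ≈ α u ∙ β v
  pair-combine {a} {b} α β u v = reflexive (cong (λ (u , v) → α u ∙ β v) (Fin.remQuot-combine {a} {b} u v))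

  record RelativeOrder {p} (P : Pred Carrier p) (x : Carrier) (q : ℕ) : Set p where
    field
      positive : 0 < q
      reached  : P (q · x)
      minimal  : ∀ {j} → 0 < j → j < q → ¬ P (j · x)

  module Adjoin {p} {P : Pred Carrier p} (H : IsSubgroup P) {x : Carrier} {q : ℕ} (order : RelativeOrder P x q) where
    open IsSubgroup H
    open RelativeOrder order

    -- The subgroup generated by P and x is P + {0, …, q − 1}·x.
    Span : Pred Carrier p
    Span y = ∃[ d ] d < q × P (y // d · x)

    representative-unique-≤ : ∀ {y d e} → e + d < q → P (y // d · x) → P (y // (e + d) · x) → e ≡ 0
    representative-unique-≤ {e = zero}        _   _  _  = refl
    representative-unique-≤ {y} {d} {suc e} e+d<q py py′ =
      contradiction (≈-closed difference (//-closed py py′)) (minimal z<s (m+n≤o⇒m≤o (suc (suc e)) e+d<q))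
      where
      difference : (y // d · x) // (y // (suc e + d) · x) ≈ suc e · x
      difference = ≈-trans (//-cong₂ ≈-refl (//-cong₂ ≈-refl (×-homo-+ x (suc e) d))) (//-//-∙-cancel y (d · x) (suc e · x))

    representative-unique : ∀ {y d d′} → d < q → d′ < q → P (y // d · x) → P (y // d′ · x) → d ≡ d′
    representative-unique {d = d} {d′} d<q d′<q py py′ with ≤-total d d′
    ... | inj₁ d≤d′ with e , refl ← ≤⇒∃+ d≤d′ = sym (cong (_+ d) (representative-unique-≤ d′<q py py′))
    ... | inj₂ d′≤d with e , refl ← ≤⇒∃+ d′≤d = cong (_+ d′) (representative-unique-≤ d<q py′ py)

    span-//-aligned : ∀ {y z d e} → e + d < q → P (y // (e + d) · x) → P (z // d · x) → Span (y // z)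
    span-//-aligned {y} {z} {d} {e} e+d<q py pz =
      e , ≤-<-trans (m≤m+n e d) e+d<q ,
      ≈-closed (≈-trans (//-cong₂ (//-cong₂ ≈-refl (×-homo-+ x e d)) ≈-refl) (//-∙-//-cancel y z (d · x) (e · x)))
               (//-closed py pz)

    -- The representative e + d of z exceeds that of y, so q · x is added back to y // z.
    span-//-wrapped : ∀ {y z d e} → 0 < e → e + d < q → P (y // d · x) → P (z // (e + d) · x) → Span (y // z)
    span-//-wrapped {y} {z} {d} {e} 0<e e+d<q py pz with f , q≡f+e ← ≤⇒∃+ (≤-trans (m≤m+n e d) (<⇒≤ e+d<q)) =
      f , subst (f <_) (sym q≡f+e) (m<m+n f 0<e) ,
      ≈-closed (//-//-∙-//-∙-cancel y z (d · x) (e · x) (f · x))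
               (//-closed (≈-closed (//-cong₂ ≈-refl (//-cong₂ ≈-refl (×-homo-+ x e d))) (//-closed py pz))
                          (≈-closed (≈-trans (×-congˡ q≡f+e) (×-homo-+ x f e)) reached))

    span-subgroup : IsSubgroup Span
    span-subgroup = record
      { ≈-closed  = λ { y≈z (d , d<q , py) → d , d<q , ≈-closed (//-cong₂ y≈z ≈-refl) py }
      ; ε-closed  = 0 , positive , ≈-closed (≈-sym (inverseʳ ε)) ε-closed
      ; //-closed = span-//
      }
      where
      span-// : ∀ {y z} → Span y → Span z → Span (y // z)
      span-// (d , d<q , py) (d′ , d′<q , pz) with d′ ≤? d
      ... | yes d′≤d with e , refl ← ≤⇒∃+ d′≤d = span-//-aligned {d = d′} {e} d<q py pz
      ... | no d′≰d with ≤⇒∃+ (<⇒≤ (≰⇒> d′≰d))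
      ...   | zero  , refl = contradiction ≤-refl d′≰d
      ...   | suc e , refl = span-//-wrapped {d = d} {suc e} z<s d′<q py pz

  adjoin-enumeration : ∀ {s} {σ : Fin s → Carrier} → SubgroupEnumeration σ →
                       ∀ {x q} → RelativeOrder (Image σ) x q → SubgroupEnumeration (extend σ x q)
  adjoin-enumeration {s} {σ} E {x} {q} order = record
    { injective = extend-injective
    ; subgroup  = IsSubgroup-⇔ span-subgroup from-span to-span
    }
    where
    open SubgroupEnumeration E
    open Adjoin subgroup order
    digits : ∀ k → σ (proj₁ (remQuot {s} q k)) ≈ extend σ x q k // toℕ (proj₂ (remQuot {s} q k)) · x
    digits k = ≈-sym (//-rightDividesʳ _ _)
    to-span : ∀ {y} → Image (extend σ x q) y → Span y
    to-span (k , ek≈y) = toℕ (proj₂ (remQuot {s} q k)) , Fin.toℕ<n _ , _ , ≈-trans (digits k) (//-cong₂ ek≈y ≈-refl)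
    from-span : ∀ {y} → Span y → Image (extend σ x q) y
    from-span {y} (d , d<q , u , σu≈y//dx) = combine u (fromℕ< d<q) , (begin
      extend σ x q (combine u (fromℕ< d<q))  ≈⟨ extend-combine σ x q u (fromℕ< d<q) ⟩
      σ u ∙ toℕ (fromℕ< d<q) · x             ≈⟨ ∙-cong σu≈y//dx (×-congˡ (Fin.toℕ-fromℕ< d<q)) ⟩
      (y // d · x) ∙ d · x                    ≈⟨ //-rightDividesˡ (d · x) y ⟩
      y                                       ∎)
    extend-injective : ∀ {k k′} → extend σ x q k ≈ extend σ x q k′ → k ≡ k′
    extend-injective {k} {k′} ek≈ek′ = remQuot-injective q (cong₂ _,_ u≡u′ w≡w′)
      where
      w≡w′ : proj₂ (remQuot {s} q k) ≡ proj₂ (remQuot {s} q k′)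
      w≡w′ = Fin.toℕ-injective (representative-unique (Fin.toℕ<n _) (Fin.toℕ<n _)
                                  (_ , digits k) (_ , ≈-trans (digits k′) (//-cong₂ (≈-sym ek≈ek′) ≈-refl)))
      u≡u′ : proj₁ (remQuot {s} q k) ≡ proj₁ (remQuot {s} q k′)
      u≡u′ = injective (≈-trans (digits k) (≈-trans (//-cong₂ ek≈ek′ (×-congˡ (cong toℕ w≡w′))) (≈-sym (digits k′))))

  ∑≡sum : ∀ n (f : Fin n → Carrier) → ∑ G n f ≡ sum f
  ∑≡sum zero    f = refl
  ∑≡sum (suc n) f = cong (f zero ∙_) (∑≡sum n (f ∘ suc))

  sum-∘-injective : ∀ {n} (f : Fin n → Carrier) (π : Fin n → Fin n) → (∀ {i j} → π i ≡ π j → i ≡ j) →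
                    sum (f ∘ π) ≈ sum f
  sum-∘-injective f π π-injective =
    ≈-sym (∑-permute f (mk↔ₛ′ π π⁻¹ (proj₂ ∘ onto) (λ i → π-injective (proj₂ (onto (π i))))))
    where
    onto : ∀ j → ∃ λ i → π i ≡ j
    onto = Fin-injective⇒surjective π π-injective
    π⁻¹ : Fin _ → Fin _
    π⁻¹ = proj₁ ∘ onto

  sum-∘-const : ∀ {n} (f : Fin n → Carrier) (π : Fin n → Fin n) {c} → (∀ i → π i ≡ c) → sum f ≈ n · f c →
                sum (f ∘ π) ≈ sum f
  sum-∘-const {n} f π π≡c sum≈ =
    ≈-trans (sum-cong-≋ (λ i → reflexive (cong f (π≡c i)))) (≈-trans (sum-replicate n) (≈-sym sum≈))

  sum-· : ∀ {n} k (f : Fin n → Carrier) → sum (λ i → k · f i) ≈ k · sum f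
  sum-· {zero}  k f = ≈-trans (≈-sym (sum-replicate-zero k)) (sum-replicate k)
  sum-· {suc n} k f = ≈-trans (∙-congˡ (sum-· k (f ∘ suc))) (≈-sym (×-distrib-+ (f zero) _ k))

  sum-↑ : ∀ m {k} (f : Fin (m + k) → Carrier) → sum f ≈ sum (λ i → f (i ↑ˡ k)) ∙ sum (λ i → f (m ↑ʳ i))
  sum-↑ zero    f = ≈-sym (identityˡ _)
  sum-↑ (suc m) f = ≈-trans (∙-congˡ (sum-↑ m (f ∘ suc))) (≈-sym (assoc _ _ _))

  sum-combine : ∀ a h (f : Fin (a * h) → Carrier) → sum f ≈ sum (λ (u : Fin a) → sum (λ (w : Fin h) → f (combine u w)))
  sum-combine zero    h f = ≈-refl
  sum-combine (suc a) h f = ≈-trans (sum-↑ h f) (∙-congˡ (sum-combine a h (λ i → f (h ↑ʳ i))))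

  sum-toℕ-· : ∀ n y → sum (λ (w : Fin n) → toℕ w · y) ≈ triangle n · y
  sum-toℕ-· zero    y = ≈-refl
  sum-toℕ-· (suc n) y = begin
    sum (λ (w : Fin (suc n)) → toℕ w · y)                  ≈⟨ sum-init-last {n} (λ w → toℕ w · y) ⟩
    sum (λ (w : Fin n) → toℕ (inject₁ w) · y) ∙ toℕ (fromℕ n) · y
                                                            ≈⟨ ∙-cong (sum-cong-≋ {n} (λ w → ×-congˡ (Fin.toℕ-inject₁ w)))
                                                                      (×-congˡ (Fin.toℕ-fromℕ n)) ⟩
    sum (λ (w : Fin n) → toℕ w · y) ∙ n · y                ≈⟨ ∙-congʳ (sum-toℕ-· n y) ⟩
    triangle n · y ∙ n · y                                 ≈⟨ ×-homo-+ y (triangle n) n ⟨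
    triangle (suc n) · y                                   ∎

  sum-extend : ∀ {a} (α : Fin a → Carrier) y h → sum (extend α y h) ≈ h · sum α ∙ a · (triangle h · y)
  sum-extend {a} α y h = begin
    sum (extend α y h)                                      ≈⟨ sum-combine a h _ ⟩
    sum (λ (u : Fin a) → sum (λ (w : Fin h) → extend α y h (combine u w)))
                                                            ≈⟨ sum-cong-≋ {a} (λ u → sum-cong-≋ {h} (extend-combine α y h u)) ⟩
    sum (λ (u : Fin a) → sum (λ (w : Fin h) → α u ∙ toℕ w · y))
                                                            ≈⟨ sum-cong-≋ {a} (λ u → ≈-trans (∑-distrib-+ {h} (λ _ → α u) (λ w → toℕ w · y))
                                                                                             (∙-cong (sum-replicate h) (sum-toℕ-· h y))) ⟩
    sum (λ u → h · α u ∙ triangle h · y)                    ≈⟨ ∑-distrib-+ {a} (λ u → h · α u) (λ _ → triangle h · y) ⟩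
    sum (λ u → h · α u) ∙ sum (λ (_ : Fin a) → triangle h · y) ≈⟨ ∙-cong (sum-· h α) (sum-replicate a) ⟩
    h · sum α ∙ a · (triangle h · y)                        ∎

  Balanced : ∀ {a} → (Fin a → Carrier) → Set ℓ
  Balanced {a} α = ∃ λ c → sum α ≈ a · α c

  -- Each progression α u, α u + y, …, α u + 2t·y sums to h times its middle term α u + t·y.
  extend-balanced : ∀ {a} {α : Fin a → Carrier} → Balanced α → ∀ y t → Balanced (extend α y (suc (t + t)))
  extend-balanced {a} {α} (c , sum≈) y t = combine c (fromℕ< t<h) , (begin
    sum (extend α y h)                          ≈⟨ sum-extend α y h ⟩
    h · sum α ∙ a · (triangle h · y)            ≈⟨ ∙-cong (×-congʳ h sum≈) (×-congʳ a (×-congˡ (triangle-odd t))) ⟩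
    h · (a · α c) ∙ a · ((t * h) · y)           ≈⟨ ∙-cong (≈-trans (×-assocˡ (α c) h a) (×-congˡ (*-comm h a)))
                                                          (≈-trans (×-assocˡ y a (t * h)) (×-congˡ (ah·t a))) ⟩
    (a * h) · α c ∙ ((a * h) * t) · y           ≈⟨ ∙-congˡ (×-assocˡ y (a * h) t) ⟨
    (a * h) · α c ∙ (a * h) · (t · y)           ≈⟨ ×-distrib-+ (α c) (t · y) (a * h) ⟨
    (a * h) · (α c ∙ t · y)                     ≈⟨ ×-congʳ (a * h) (∙-congˡ (×-congˡ (Fin.toℕ-fromℕ< t<h))) ⟨
    (a * h) · (α c ∙ toℕ (fromℕ< t<h) · y)     ≈⟨ ×-congʳ (a * h) (extend-combine α y h c (fromℕ< t<h)) ⟨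
    (a * h) · extend α y h (combine c (fromℕ< t<h)) ∎)
    where
    h : ℕ
    h = suc (t + t)
    t<h : t < h
    t<h = s≤s (m≤m+n t t)
    ah·t : ∀ a → a * (t * h) ≡ a * h * t
    ah·t a = trans (cong (a *_) (*-comm t h)) (sym (*-assoc a h t))

  digits-merge : ∀ p r w w′ g x → (p ∙ w · x) ∙ (r ∙ w′ · (g · x)) ≈ (p ∙ r) ∙ (g * w′ + w) · x
  digits-merge p r w w′ g x = begin
    (p ∙ w · x) ∙ (r ∙ w′ · (g · x))  ≈⟨ ∙-congˡ (∙-congˡ (×-assocˡ x w′ g)) ⟩
    (p ∙ w · x) ∙ (r ∙ (w′ * g) · x)
      ≈⟨ solve 4 (λ p a r b → (p ⊕ a) ⊕ (r ⊕ b) ⊜ (p ⊕ r) ⊕ (b ⊕ a)) ≈-refl p (w · x) r ((w′ * g) · x) ⟩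
    (p ∙ r) ∙ ((w′ * g) · x ∙ w · x)  ≈⟨ ∙-congˡ (×-homo-+ x (w′ * g) w) ⟨
    (p ∙ r) ∙ (w′ * g + w) · x        ≈⟨ ∙-congˡ (×-congˡ (cong (_+ w) (*-comm w′ g))) ⟩
    (p ∙ r) ∙ (g * w′ + w) · x        ∎

  pair-extend≈extend-pair : ∀ {a b g h} (α : Fin a → Carrier) (β : Fin b → Carrier) x k →
    pair (extend α x g) (extend β (g · x) h) k ≈ extend (pair α β) x (h * g) (Inverse.to (regroup {a} {g} {b} {h}) k)
  pair-extend≈extend-pair {a} {b} {g} {h} α β x k = begin
    (α u ∙ toℕ w · x) ∙ (β v ∙ toℕ w′ · (g · x))     ≈⟨ digits-merge (α u) (β v) (toℕ w) (toℕ w′) g x ⟩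
    (α u ∙ β v) ∙ (g * toℕ w′ + toℕ w) · x           ≈⟨ ∙-cong (pair-combine α β u v) (×-congˡ (Fin.toℕ-combine w′ w)) ⟨
    pair α β (combine u v) ∙ toℕ (combine w′ w) · x  ≈⟨ extend-combine (pair α β) x (h * g) (combine u v) (combine w′ w) ⟨
    extend (pair α β) x (h * g) (combine (combine u v) (combine w′ w)) ∎
    where
    u : Fin a
    w : Fin g
    v : Fin b
    w′ : Fin h
    u = proj₁ (remQuot {a} g (proj₁ (remQuot {a * g} (b * h) k)))
    w = proj₂ (remQuot {a} g (proj₁ (remQuot {a * g} (b * h) k)))
    v = proj₁ (remQuot {b} h (proj₂ (remQuot {a * g} (b * h) k)))
    w′ = proj₂ (remQuot {b} h (proj₂ (remQuot {a * g} (b * h) k)))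

  record BalancedFactorisation (a b : ℕ) : Set (c ⊔ ℓ) where
    field
      α           : Fin a → Carrier
      β           : Fin b → Carrier
      α-balanced  : Balanced α
      β-balanced  : Balanced β
      enumeration : SubgroupEnumeration (pair α β)

  module _ {N} (order : HasOrder G N) where

    enum : Fin N → Carrier
    enum = proj₁ order

    index : Carrier → Fin N
    index y = proj₁ (proj₂ (proj₂ order) y)

    enum-index : ∀ y → enum (index y) ≈ y
    enum-index y = proj₂ (proj₂ (proj₂ order) y) refl

    index-injective : ∀ {x y} → index x ≡ index y → x ≈ y
    index-injective {x} {y} eq = ≈-trans (≈-sym (enum-index x)) (≈-trans (reflexive (cong enum eq)) (enum-index y))

    index-cong : ∀ {x y} → x ≈ y → index x ≡ index y
    index-cong {x} {y} x≈y = proj₁ (proj₂ order) (≈-trans (enum-index x) (≈-trans x≈y (≈-sym (enum-index y))))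

    _≈?_ : ∀ x y → Dec (x ≈ y)
    x ≈? y with index x Fin.≟ index y
    ... | yes eq = yes (index-injective eq)
    ... | no neq = no (neq ∘ index-cong)

    Covers : ∀ {s} → (Fin s → Carrier) → Set ℓ
    Covers σ = ∀ i → Image σ (enum i)

    image? : ∀ {s} (σ : Fin s → Carrier) → Decidable (Image σ)
    image? σ y = Fin.any? (λ u → σ u ≈? y)

    injective⇒bijective : ∀ {A : Set} (π : A ↔ Fin N) (f : A → Carrier) →
                          (∀ {x y} → f x ≈ f y → x ≡ y) → Bijective _≡_ _≈_ f
    injective⇒bijective π f f-injective = f-injective , onto
      where
      open Inverse π
      onto : ∀ y → ∃ λ x → ∀ {z} → z ≡ x → f z ≈ y
      onto y with i , eq ← Fin-injective⇒surjective (index ∘ f ∘ from)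
                             (λ eq → trans (sym (strictlyInverseˡ _))
                                       (trans (cong to (f-injective (index-injective eq))) (strictlyInverseˡ _)))
                             (index y)
        = from i , λ { refl → index-injective eq }

    finite-order : ∀ x → ∃[ m ] 0 < m × m · x ≈ ε
    finite-order x with i , j , i<j , eq ← Fin.pigeonhole (n<1+n N) (λ (i : Fin (suc N)) → index (toℕ i · x)) =
      toℕ j ∸ toℕ i , m<n⇒0<n∸m i<j , (begin
        (toℕ j ∸ toℕ i) · x                        ≈⟨ //-rightDividesʳ _ _ ⟨
        (toℕ j ∸ toℕ i) · x ∙ toℕ i · x // toℕ i · x ≈⟨ //-cong₂ (≈-sym (×-homo-+ x (toℕ j ∸ toℕ i) (toℕ i))) ≈-refl ⟩
        (toℕ j ∸ toℕ i + toℕ i) · x // toℕ i · x  ≈⟨ //-cong₂ (×-congˡ (m∸n+n≡m (<⇒≤ i<j))) (index-injective eq) ⟩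
        toℕ j · x // toℕ j · x                     ≈⟨ inverseʳ _ ⟩
        ε                                          ∎)

    relative-order : ∀ {p} {P : Pred Carrier p} → IsSubgroup P → Decidable P → ∀ x → ∃ (RelativeOrder P x)
    relative-order H P? x with suc m , _ , m·x≈ε ← finite-order x
      with k , pk , below ← least (λ k → P? (suc k · x)) {m} (IsSubgroup.≈-closed H (≈-sym m·x≈ε) (IsSubgroup.ε-closed H))
      = suc k , record { positive = z<s ; reached = pk ; minimal = λ { {suc j} _ (s≤s j<k) → below j<k } }

    enumeration-size≤ : ∀ {s} {σ : Fin s → Carrier} → SubgroupEnumeration σ → s ≤ N
    enumeration-size≤ E = Fin.injective⇒≤ (SubgroupEnumeration.injective E ∘ index-injective)

    enumeration-covers⇒size≡ : ∀ {s} {σ : Fin s → Carrier} → SubgroupEnumeration σ → Covers σ → s ≡ N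
    enumeration-covers⇒size≡ {σ = σ} E covers = Fin.cantor-schröder-bernstein
      (SubgroupEnumeration.injective E ∘ index-injective)
      (λ {i} {j} eq → proj₁ (proj₂ order)
                        (≈-trans (≈-sym (proj₂ (covers i))) (≈-trans (reflexive (cong σ eq)) (proj₂ (covers j)))))

    covers-or-misses : ∀ {s} (σ : Fin s → Carrier) → Covers σ ⊎ ∃ λ x → ¬ Image σ x
    covers-or-misses σ with Fin.all? (λ i → image? σ (enum i))
    ... | yes covers = inj₁ covers
    ... | no ¬covers = inj₂ (enum (proj₁ missing) , proj₂ missing)
      where
      missing : ∃ λ i → ¬ Image σ (enum i)
      missing = Fin.¬∀⟶∃¬ N _ (λ i → image? σ (enum i)) ¬covers

    adjoin-grows : ∀ {s} {σ : Fin s → Carrier} → SubgroupEnumeration σ → ∀ {x} → ¬ Image σ x →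
                   ∃ λ q → RelativeOrder (Image σ) x q × s < s * q
    adjoin-grows {s} {σ} E {x} x∉σ with q , ord ← relative-order (SubgroupEnumeration.subgroup E) (image? σ) x =
      q , ord , m<m*n s q (1<q q ord)
      where
      instance
        s≢0 : NonZero s
        s≢0 = ≢-nonZero λ { refl → Fin.¬Fin0 (proj₁ (IsSubgroup.ε-closed (SubgroupEnumeration.subgroup E))) }
      1<q : ∀ q → RelativeOrder (Image σ) x q → 1 < q
      1<q (suc (suc _)) _   = s≤s z<s
      1<q 1             ord = contradiction
        (IsSubgroup.≈-closed (SubgroupEnumeration.subgroup E) (identityʳ x) (RelativeOrder.reached ord)) x∉σ

    -- Adjoin missing elements until Γ is exhausted; every step multiplies the size.
    lagrange : ∀ {s} {σ : Fin s → Carrier} → SubgroupEnumeration σ → s ∣ N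
    lagrange {s} {σ} E = finish (bounded-ascent proj₁ N bounded step (s , σ , E , ∣-refl))
      where
      State : Set (c ⊔ ℓ)
      State = Σ ℕ λ s′ → Σ (Fin s′ → Carrier) λ σ′ → SubgroupEnumeration σ′ × s ∣ s′
      Done : State → Set ℓ
      Done (_ , σ′ , _) = Covers σ′
      bounded : ∀ (st : State) → proj₁ st ≤ N
      bounded (_ , _ , E′ , _) = enumeration-size≤ E′
      step : ∀ (st : State) → Done st ⊎ ∃ λ st′ → proj₁ st < proj₁ st′
      step (s′ , σ′ , E′ , s∣s′) with covers-or-misses σ′
      ... | inj₁ covers   = inj₁ covers
      ... | inj₂ (x , x∉) with q , ord , grows ← adjoin-grows E′ x∉ =
        inj₂ ((s′ * q , extend σ′ x q , adjoin-enumeration E′ ord , ∣-trans s∣s′ (m∣m*n q)) , grows)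
      finish : ∃ Done → s ∣ N
      finish ((_ , _ , E′ , s∣s′) , covers) = subst (s ∣_) (enumeration-covers⇒size≡ E′ covers) s∣s′

    Approximation : ℕ → Set (c ⊔ ℓ)
    Approximation n = Σ ℕ λ a → Σ ℕ λ b → BalancedFactorisation a b × a ∣ n × b ∣ n

    refine : ∀ {n} .{{_ : NonZero n}} → N ≡ n * n → n % 2 ≡ 1 → ∀ {a b} (F : BalancedFactorisation a b) →
             a ∣ n → b ∣ n → ∀ {x} → ¬ Image (pair (BalancedFactorisation.α F) (BalancedFactorisation.β F)) x →
             ∃ λ (F′ : Approximation n) → a * b < proj₁ F′ * proj₁ (proj₂ F′)
    refine N≡n*n n-odd {a} {b} F a∣n b∣n {x} x∉
      with q , ord , grows ← adjoin-grows (BalancedFactorisation.enumeration F) x∉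
      with g , q′ , refl , ag∣n , bq′∣n ← index-split a∣n b∣n
             (subst (a * b * q ∣_) N≡n*n (lagrange (adjoin-enumeration (BalancedFactorisation.enumeration F) ord)))
      with tg , refl ← odd-divisor (m*n∣⇒n∣ a g ag∣n) n-odd
      with tq , refl ← odd-divisor (m*n∣⇒n∣ b q′ bq′∣n) n-odd
      = (a * g , b * q′ , F′ , ag∣n , bq′∣n) , subst (a * b <_) (sym (sizes a g b q′)) grows
      where
      open BalancedFactorisation F
      sizes : ∀ a g b q′ → a * g * (b * q′) ≡ a * b * (q′ * g)
      sizes = solve-∀
      F′ : BalancedFactorisation (a * g) (b * q′)
      F′ = record
        { α           = extend α x g
        ; β           = extend β (g · x) q′
        ; α-balanced  = extend-balanced α-balanced x tg
        ; β-balanced  = extend-balanced β-balanced (g · x) tq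
        ; enumeration = enumeration-reindex (adjoin-enumeration enumeration ord) (regroup {a} {g} {b} {q′})
                                            (pair-extend≈extend-pair α β x)
        }

    balanced-factorisation : ∀ {n} .{{_ : NonZero n}} → N ≡ n * n → n % 2 ≡ 1 → BalancedFactorisation n n
    balanced-factorisation {n} N≡n*n n-odd = finish (bounded-ascent size N bounded step trivial)
      where
      size : Approximation n → ℕ
      size (a , b , _) = a * b
      bounded : ∀ F → size F ≤ N
      bounded (_ , _ , F , _) = enumeration-size≤ (BalancedFactorisation.enumeration F)
      trivial : Approximation n
      trivial = 1 , 1 , record
        { α = λ _ → ε ; β = λ _ → ε ; α-balanced = zero , ≈-refl ; β-balanced = zero , ≈-refl
        ; enumeration = enumeration-reindex trivial-enumeration (↔-id _) (λ _ → identityˡ ε)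
        } , 1∣ n , 1∣ n
      Done : Approximation n → Set ℓ
      Done (_ , _ , F , _) = Covers (pair α β)
        where open BalancedFactorisation F
      step : ∀ F → Done F ⊎ ∃ λ F′ → size F < size F′
      step (a , b , F , a∣n , b∣n) with covers-or-misses (pair α β)
        where open BalancedFactorisation F
      ... | inj₁ covers   = inj₁ covers
      ... | inj₂ (x , x∉) = inj₂ (refine N≡n*n n-odd F a∣n b∣n x∉)
      finish : ∃ Done → BalancedFactorisation n n
      finish ((a , b , F , a∣n , b∣n) , covers)
        with refl , refl ← divisors-product-square a∣n b∣n
                             (trans (enumeration-covers⇒size≡ (BalancedFactorisation.enumeration F) covers) N≡n*n)
        = F

  -- A i j = i + j + 1 + a and B i j = i − j + b (mod n), where a and b are the centres of α and β.
  magic-square : ∀ {m} → HasOrder G (suc m * suc m) → Coprime (suc m) 2 →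
                 BalancedFactorisation (suc m) (suc m) → MagicSquare G (suc m)
  magic-square {m} order n⊥2 F = record
    { entry       = entry
    ; allOnce     = injective⇒bijective order (↔-sym Fin.*↔×) (uncurry entry) entry-injective
    ; μ           = sum α ∙ sum β
    ; rowSum      = λ i → line (A i) (B i)
                      (sum-∘-injective α (A i) (latin-injectiveʳ K₁ i))
                      (sum-∘-injective β (B i) (opposite-injective ∘ latin-injectiveʳ K₂ i))
    ; colSum      = λ j → line (λ i → A i j) (λ i → B i j)
                      (sum-∘-injective α (λ i → A i j) (latin-injectiveˡ K₁ j))
                      (sum-∘-injective β (λ i → B i j) (latin-injectiveˡ K₂ (opposite j)))
    ; diagSum     = line (λ i → A i i) (λ i → B i i)
                      (sum-∘-injective α (λ i → A i i) (latin-diagonal-injective n⊥2 K₁))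
                      (sum-∘-const β (λ i → B i i) (latin-antidiagonal cβ) β-centred)
    ; antiDiagSum = line (λ i → A i (opposite i)) (λ i → B i (opposite i))
                      (sum-∘-const α (λ i → A i (opposite i)) (latin-antidiagonal cα) α-centred)
                      (sum-∘-injective β (λ i → B i (opposite i)) B-antidiagonal-injective)
    }
    where
    open BalancedFactorisation F
    open Latin m
    cα cβ : Fin n
    cα = proj₁ α-balanced
    cβ = proj₁ β-balanced
    α-centred : sum α ≈ n · α cα
    α-centred = proj₂ α-balanced
    β-centred : sum β ≈ n · β cβ
    β-centred = proj₂ β-balanced
    K₁ K₂ : ℕ
    K₁ = suc (toℕ cα)
    K₂ = suc (toℕ cβ)
    A B : Fin n → Fin n → Fin n
    A i j = latin K₁ i j
    B i j = latin K₂ i (opposite j)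
    entry : Fin n → Fin n → Carrier
    entry i j = α (A i j) ∙ β (B i j)

    line : ∀ (f g : Fin n → Fin n) → sum (α ∘ f) ≈ sum α → sum (β ∘ g) ≈ sum β →
           ∑ G n (λ i → α (f i) ∙ β (g i)) ≈ sum α ∙ sum β
    line f g αf≈ βg≈ = ≈-trans (reflexive (∑≡sum n (λ i → α (f i) ∙ β (g i))))
                               (≈-trans (∑-distrib-+ (α ∘ f) (β ∘ g)) (∙-cong αf≈ βg≈))

    B-antidiagonal-injective : ∀ {i i′} → B i (opposite i) ≡ B i′ (opposite i′) → i ≡ i′
    B-antidiagonal-injective {i} {i′} eq = latin-diagonal-injective n⊥2 K₂
      (trans (cong (latin K₂ i) (sym (Fin.opposite-involutive i))) (trans eq (cong (latin K₂ i′) (Fin.opposite-involutive i′))))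

    entry-injective : ∀ {p p′} → uncurry entry p ≈ uncurry entry p′ → p ≡ p′
    entry-injective {i , j} {i′ , j′} eq = cong₂ _,_ (proj₁ orthogonal) (proj₂ orthogonal)
      where
      combined : combine (A i j) (B i j) ≡ combine (A i′ j′) (B i′ j′)
      combined = SubgroupEnumeration.injective enumeration
        (≈-trans (pair-combine α β _ _) (≈-trans eq (≈-sym (pair-combine α β _ _))))
      orthogonal : i ≡ i′ × j ≡ j′
      orthogonal = latin-orthogonal n⊥2 K₁ K₂ (Fin.combine-injectiveˡ (A i j) (B i j) (A i′ j′) (B i′ j′) combined)
                                             (Fin.combine-injectiveʳ (A i j) (B i j) (A i′ j′) (B i′ j′) combined)

theorem5p1 : {c ℓ : Level} (Γ : AbelianGroup c ℓ) (n : ℕ) →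
    3 ≤ n → n % 2 ≡ 1 → HasOrder Γ (n * n) → MagicSquare Γ n
theorem5p1 Γ zero    ()
theorem5p1 Γ (suc m) _  n-odd order =
  magic-square Γ order (%2≡1⇒coprime-2 n-odd) (balanced-factorisation Γ order {suc m} refl n-odd)
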